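{- Let $q>2$ be a prime power and $F=\mathbb{F}_{q^3}$. Let $\alpha=-1$ if $q$ is odd and let $\alpha$ be an element of $\mathbb{F}_q\setminus\{0,1\}$ if $q$ is even. For $a_0,a_1\in F$ let $M(a_0,a_1)=\begin{pmatrix}a_0&a_1&a_1^{q^2}\\ a_1&a_0^q&a_1^q\\ a_1^{q^2}&a_1^q&a_0^{q^2}\end{pmatrix}$, let $W=\{M(a_0,a_1):a_0,a_1\in F\}$ (a $6$-dimensional $\mathbb{F}_q$-vector space) and $\mathrm{PG}(W)\cong\mathrm{PG}(5,q)$ its projective space. For $\omega\in F^*$ let $\mathcal{V}_\omega$ be the set of points spanned by $M(x^2,\omega x^{q+1})$, $x\in F^*$, and let $\mathcal{S}_\omega$ be the image of $\mathcal{S}_1=\{\langle M(a_0,a_1)\rangle:\det M(a_0,a_1)=0\}$ under the projectivity induced by $M(a_0,a_1)\mapsto M(a_0,\omega a_1)$. Then $\mathcal{S}_1$ and $\mathcal{S}_\alpha$ are disjoint if $q$ is odd, and if $q$ is even they meet only in points of the common nuclear plane of $\mathcal{V}_1$ and $\mathcal{V}_\alpha$.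
   Context: $\mathcal{V}_1$ is the standard Veronese variety of $\mathrm{PG}(W)$ and $\mathcal{S}_1$ its chordal variety (points whose matrix has rank at most $2$). For $q$ even, the nuclear plane of a Veronese surface of $\mathrm{PG}(5,q)$ is the plane containing the nuclei of all its conics; for $\mathcal{V}_1$ and for $\mathcal{V}_\alpha$ it is the plane consisting of the points spanned by $M(0,a_1)$, $a_1\in F^*$. -}

module Defs where

open import Level using (0ℓ)
open import Data.Nat as ℕ using (ℕ; suc)
open import Data.Nat.Primality using (Prime)
open import Data.Fin using (Fin; zero; suc)
open import Data.Product using (Σ; ∃; _×_; _,_)
open import Relation.Nullary using (¬_)
open import Relation.Binary.PropositionalEquality as ≡ using (_≡_)
open import Algebra.Bundles using (CommutativeRing)
import Algebra.Bundles
open import Function.Bundles using (Bijection)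
import Algebra.Definitions.RawSemiring as RS

IsPrimePower : ℕ → Set
IsPrimePower q = Σ ℕ λ p → Σ ℕ λ k → Prime p × q ≡ p ℕ.^ suc k

record FiniteField (n : ℕ) : Set₁ where
  field
    commRing : CommutativeRing 0ℓ 0ℓ
  open CommutativeRing commRing public
  open RS (Algebra.Bundles.Semiring.rawSemiring semiring) public using (_^_)
  field
    0≉1     : ¬ (0# ≈ 1#)
    inverse : ∀ x → ¬ (x ≈ 0#) → Σ Carrier λ y → x * y ≈ 1#
    card    : Bijection (≡.setoid (Fin n)) setoid

module Geometry {n : ℕ} (q : ℕ) (K : FiniteField n) where
  open FiniteField K hiding (zero)

  InFq : Carrier → Set
  InFq c = c ^ q ≈ c

  M : Carrier → Carrier → Fin 3 → Fin 3 → Carrier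
  M a0 a1 zero zero = a0
  M a0 a1 zero (suc zero) = a1
  M a0 a1 zero (suc (suc zero)) = a1 ^ (q ℕ.* q)
  M a0 a1 (suc zero) zero = a1
  M a0 a1 (suc zero) (suc zero) = a0 ^ q
  M a0 a1 (suc zero) (suc (suc zero)) = a1 ^ q
  M a0 a1 (suc (suc zero)) zero = a1 ^ (q ℕ.* q)
  M a0 a1 (suc (suc zero)) (suc zero) = a1 ^ q
  M a0 a1 (suc (suc zero)) (suc (suc zero)) = a0 ^ (q ℕ.* q)

  det3 : (Fin 3 → Fin 3 → Carrier) → Carrier
  det3 A =
      A zero zero * (A one one * A two two - A one two * A two one)
    - A zero one * (A one zero * A two two - A one two * A two zero)
    + A zero two * (A one zero * A two one - A one one * A two zero)
    where
      one two : Fin 3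
      one = suc zero
      two = suc (suc zero)

  -- M(a0,a1) is a nonzero vector of W (W ≅ F × F as F_q-space)
  NonzeroVec : Carrier → Carrier → Set
  NonzeroVec a0 a1 = ¬ (a0 ≈ 0# × a1 ≈ 0#)

  -- ⟨M(a0,a1)⟩ = ⟨M(b0,b1)⟩ in PG(W): proportional by a scalar in F_q^*
  SamePoint : Carrier → Carrier → Carrier → Carrier → Set
  SamePoint a0 a1 b0 b1 =
    Σ Carrier λ c → InFq c × ¬ (c ≈ 0#) × a0 ≈ c * b0 × a1 ≈ c * b1

  InS1 : Carrier → Carrier → Set
  InS1 a0 a1 = NonzeroVec a0 a1 × det3 (M a0 a1) ≈ 0#

  InS : Carrier → Carrier → Carrier → Set
  InS ω a0 a1 =
    Σ Carrier λ b0 → Σ Carrier λ b1 → InS1 b0 b1 × SamePoint a0 a1 b0 (ω * b1)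

  -- the (common) nuclear plane: points spanned by M(0,c1), c1 ∈ F^*
  InNuclearPlane : Carrier → Carrier → Set
  InNuclearPlane a0 a1 =
    NonzeroVec a0 a1 × Σ Carrier λ c1 → ¬ (c1 ≈ 0#) × SamePoint a0 a1 0# c1

{-# OPTIONS --safe #-}
module Submission where

-- Let ⟨M(a0, a1)⟩ lie in S1 and in S_t (t = -1 or α), say (a0, a1) = c (b0, t b1) with ⟨M(b0, b1)⟩ ∈ S1
-- and c ∈ F_q^*. Writing A, B, C and x, y, z for the conjugates under x ↦ x^q of b0 and b1, the matrix
-- M(b0, t b1) is symmetric with diagonal A, B, C and off-diagonal t x, t y, t z, so
--   det M(a0, a1) = c³ Δ_t,   Δ_t = ABC + 2t³ xyz − t² Q,   Q = Ay² + Cx² + Bz²,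
-- because c and t are fixed by Frobenius. Both Δ_1 and Δ_t vanish. For t = -1 their difference is
-- 4 xyz = 4 N(b1), so for odd q we get b1 = 0 and then det M(b0, b1) = N(b0) gives b0 = 0. In characteristic 2
-- the difference is (t − 1)² Q, so Q = 0 and N(b0) = Δ_1 + Q − 2 N(b1) = 0; hence a0 = 0, which is the
-- nuclear plane. The characteristic of F is read off from the parity of |F| = q³ by counting fixed points
-- of an involution of F.

open import Defs
open import Data.Nat using (ℕ; _<_)
open import Data.Nat.Divisibility using (_∣_)
open import Data.Product using (_×_; _,_)
open import Relation.Nullary using (¬_)

open import Algebra.Bundles using (CommutativeRing; Semiring)
import Algebra.Definitions.RawSemiring as RawSemiring
import Data.Nat as ℕ
open import Data.Nat.Divisibility using (∣1⇒≡1; ∣m⇒∣m*n)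
open import Data.Nat.Primality using (Prime; prime[2]; ¬prime[1]; euclidsLemma)
open import Data.Sum using (inj₁; inj₂)
open import Function.Base using (_∘_)
import Relation.Binary.PropositionalEquality as ≡
open import Relation.Nullary using (contradiction)

module IntegerCoefficients {c ℓ} (R : CommutativeRing c ℓ) where
  open import Data.Integer as ℤ using (ℤ; +_; -[1+_]; sign; ∣_∣)
  import Data.Integer.Properties as ℤ
  import Data.Maybe as Maybe
  open import Data.Nat.Base using (zero; suc)
  import Data.Nat.Properties as ℕ
  open import Data.Sign as Sign using (Sign)
  open import Relation.Nullary.Decidable using (dec⇒maybe)
  open ≡ using (cong)
  open CommutativeRing R
  open import Algebra.Properties.Ring ring using (-1*x≈-x; -‿involutive; -0#≈0#; -‿+-comm)
  open import Algebra.Properties.Semiring.Mult.TCOptimised semiring using (1+×; ×-homo-+; ×1-homo-*)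
    renaming (_×_ to _·_)
  open import Algebra.Properties.CommutativeSemigroup *-commutativeSemigroup using (interchange)
  open import Algebra.Solver.Ring.AlmostCommutativeRing using (fromCommutativeRing; _-Raw-AlmostCommutative⟶_)
  open import Relation.Binary.Reasoning.Setoid setoid

  -- The optimised multiplication makes ⟦ + 1 ⟧ᶻ and ⟦ + 2 ⟧ᶻ reduce to 1# and 1# + 1#.
  ⟦_⟧ᶻ : ℤ → Carrier
  ⟦ + n ⟧ᶻ = n · 1#
  ⟦ -[1+ n ] ⟧ᶻ = - (suc n · 1#)

  private
    ⟦_⟧ₛ : Sign → Carrier
    ⟦ Sign.+ ⟧ₛ = 1#
    ⟦ Sign.- ⟧ₛ = - 1#

    ⟦◃⟧ : ∀ s n → ⟦ s ℤ.◃ n ⟧ᶻ ≈ ⟦ s ⟧ₛ * (n · 1#)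
    ⟦◃⟧ s      zero    = sym (zeroʳ _)
    ⟦◃⟧ Sign.+ (suc n) = sym (*-identityˡ _)
    ⟦◃⟧ Sign.- (suc n) = sym (-1*x≈-x _)

    ⟦sign◃∣∣⟧ : ∀ i → ⟦ sign i ⟧ₛ * (∣ i ∣ · 1#) ≈ ⟦ i ⟧ᶻ
    ⟦sign◃∣∣⟧ i = trans (sym (⟦◃⟧ (sign i) ∣ i ∣)) (reflexive (cong ⟦_⟧ᶻ (ℤ.◃-inverse i)))

    ⟦⟧ₛ-homo-* : ∀ s t → ⟦ s Sign.* t ⟧ₛ ≈ ⟦ s ⟧ₛ * ⟦ t ⟧ₛ
    ⟦⟧ₛ-homo-* Sign.+ t      = sym (*-identityˡ _)
    ⟦⟧ₛ-homo-* Sign.- Sign.+ = sym (*-identityʳ _)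
    ⟦⟧ₛ-homo-* Sign.- Sign.- = sym (trans (-1*x≈-x (- 1#)) (-‿involutive 1#))

    *-homo : ∀ i j → ⟦ i ℤ.* j ⟧ᶻ ≈ ⟦ i ⟧ᶻ * ⟦ j ⟧ᶻ
    *-homo i j = begin
      ⟦ (sign i Sign.* sign j) ℤ.◃ (∣ i ∣ ℕ.* ∣ j ∣) ⟧ᶻ
        ≈⟨ ⟦◃⟧ (sign i Sign.* sign j) (∣ i ∣ ℕ.* ∣ j ∣) ⟩
      ⟦ sign i Sign.* sign j ⟧ₛ * ((∣ i ∣ ℕ.* ∣ j ∣) · 1#)
        ≈⟨ *-cong (⟦⟧ₛ-homo-* (sign i) (sign j)) (×1-homo-* ∣ i ∣ ∣ j ∣) ⟩
      (⟦ sign i ⟧ₛ * ⟦ sign j ⟧ₛ) * ((∣ i ∣ · 1#) * (∣ j ∣ · 1#))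
        ≈⟨ interchange _ _ _ _ ⟩
      (⟦ sign i ⟧ₛ * (∣ i ∣ · 1#)) * (⟦ sign j ⟧ₛ * (∣ j ∣ · 1#))
        ≈⟨ *-cong (⟦sign◃∣∣⟧ i) (⟦sign◃∣∣⟧ j) ⟩
      ⟦ i ⟧ᶻ * ⟦ j ⟧ᶻ ∎

    [1+x]-[1+y]≈x-y : ∀ x y → (1# + x) - (1# + y) ≈ x - y
    [1+x]-[1+y]≈x-y x y = begin
      (1# + x) + - (1# + y)   ≈⟨ +-congˡ (sym (-‿+-comm 1# y)) ⟩
      (1# + x) + (- 1# + - y) ≈⟨ +-congʳ (+-comm 1# x) ⟩
      (x + 1#) + (- 1# + - y) ≈⟨ +-assoc x 1# _ ⟩
      x + (1# + (- 1# + - y)) ≈⟨ +-congˡ (sym (+-assoc 1# (- 1#) (- y))) ⟩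
      x + ((1# - 1#) + - y)   ≈⟨ +-congˡ (+-congʳ (-‿inverseʳ 1#)) ⟩
      x + (0# + - y)          ≈⟨ +-congˡ (+-identityˡ (- y)) ⟩
      x - y                   ∎

    ⊖-homo : ∀ m n → ⟦ m ℤ.⊖ n ⟧ᶻ ≈ m · 1# - n · 1#
    ⊖-homo m       zero    = sym (trans (+-congˡ -0#≈0#) (+-identityʳ _))
    ⊖-homo zero    (suc n) = sym (+-identityˡ _)
    ⊖-homo (suc m) (suc n) = begin
      ⟦ suc m ℤ.⊖ suc n ⟧ᶻ           ≡⟨ cong ⟦_⟧ᶻ (ℤ.[1+m]⊖[1+n]≡m⊖n m n) ⟩
      ⟦ m ℤ.⊖ n ⟧ᶻ                   ≈⟨ ⊖-homo m n ⟩
      m · 1# - n · 1#               ≈⟨ [1+x]-[1+y]≈x-y _ _ ⟨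
      (1# + m · 1#) - (1# + n · 1#) ≈⟨ +-cong (1+× m 1#) (-‿cong (1+× n 1#)) ⟨
      suc m · 1# - suc n · 1#       ∎

    +-homo : ∀ i j → ⟦ i ℤ.+ j ⟧ᶻ ≈ ⟦ i ⟧ᶻ + ⟦ j ⟧ᶻ
    +-homo (+ m)    (+ n)    = ×-homo-+ 1# m n
    +-homo (+ m)    -[1+ n ] = ⊖-homo m (suc n)
    +-homo -[1+ m ] (+ n)    = trans (⊖-homo n (suc m)) (+-comm _ _)
    +-homo -[1+ m ] -[1+ n ] = begin
      - (suc (suc m ℕ.+ n) · 1#)      ≡⟨ cong (λ k → - (suc k · 1#)) (ℕ.+-suc m n) ⟨
      - ((suc m ℕ.+ suc n) · 1#)      ≈⟨ -‿cong (×-homo-+ 1# (suc m) (suc n)) ⟩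
      - (suc m · 1# + suc n · 1#)     ≈⟨ -‿+-comm _ _ ⟨
      - (suc m · 1#) + - (suc n · 1#) ∎

    -‿homo : ∀ i → ⟦ ℤ.- i ⟧ᶻ ≈ - ⟦ i ⟧ᶻ
    -‿homo (+ zero)  = sym -0#≈0#
    -‿homo (+ suc n) = refl
    -‿homo -[1+ n ]  = sym (-‿involutive _)

  homomorphism : ℤ.+-*-rawRing -Raw-AlmostCommutative⟶ fromCommutativeRing R
  homomorphism = record
    { ⟦_⟧ = ⟦_⟧ᶻ ; +-homo = +-homo ; *-homo = *-homo ; -‿homo = -‿homo
    ; 0-homo = refl ; 1-homo = refl
    }

  open import Algebra.Solver.Ring ℤ.+-*-rawRing (fromCommutativeRing R) homomorphism
    (λ i j → Maybe.map (reflexive ∘ cong ⟦_⟧ᶻ) (dec⇒maybe (i ℤ.≟ j))) public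

module FinInvolution where
  open import Data.Bool.Base using (if_then_else_)
  open import Data.Fin.Base using (Fin; punchIn)
  open import Function.Bundles using (Inverse)
  open import Relation.Binary.Bundles using (Setoid)
  open import Algebra.Definitions using (Congruent₁; Involutive)
  open import Data.Fin.Permutation using (permutation)
  import Data.Fin.Properties as Fin
  open import Data.Nat.Base using (suc; _+_; _*_)
  import Data.Nat.Properties as ℕ
  open import Data.Nat.Divisibility using (divides; ∣m+n∣m⇒∣n; m∣m*n)
  open import Relation.Binary.Definitions using (tri<; tri≈; tri>)
  open import Relation.Nullary using (Dec; does)
  open import Relation.Nullary.Decidable using (dec-true; dec-false)
  open ≡ using (_≡_; _≢_; refl; cong; cong₂)
  open import Algebra.Properties.CommutativeMonoid.Sum ℕ.+-0-commutativeMonoid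
    using (sum; sum-permute; ∑-distrib-+; sum-cong-≗; sum-replicate-zero; sum-remove)

  [_] : ∀ {p} {P : Set p} → Dec P → ℕ
  [ P? ] = if does P? then 1 else 0

  []-yes : ∀ {p} {P : Set p} (P? : Dec P) → P → [ P? ] ≡ 1
  []-yes P? p rewrite dec-true P? p = refl

  []-no : ∀ {p} {P : Set p} (P? : Dec P) → ¬ P → [ P? ] ≡ 0
  []-no P? ¬p rewrite dec-false P? ¬p = refl

  sum-unitVector : ∀ {m} (f : Fin m → ℕ) i₀ → f i₀ ≡ 1 → (∀ i → i ≢ i₀ → f i ≡ 0) → sum f ≡ 1
  sum-unitVector {suc m} f i₀ fi₀≡1 f≡0 = begin
    sum f                       ≡⟨ sum-remove {i = i₀} f ⟩
    f i₀ + sum (f ∘ punchIn i₀) ≡⟨ cong₂ _+_ fi₀≡1 (sum-cong-≗ λ j → f≡0 _ (Fin.punchInᵢ≢i i₀ j)) ⟩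
    1 + sum {m} (λ _ → 0)       ≡⟨ cong suc (sum-replicate-zero m) ⟩
    1                           ∎
    where open ≡.≡-Reasoning

  module InvolutionParity {n : ℕ} (σ : Fin n → Fin n) (σ-involutive : ∀ i → σ (σ i) ≡ i) where
    fixedPoints ascents : ℕ
    fixedPoints = sum λ i → [ σ i Fin.≟ i ]
    ascents     = sum λ i → [ i Fin.<? σ i ]

    private
      asc desc : Fin n → ℕ
      asc i  = [ i Fin.<? σ i ]
      desc i = [ σ i Fin.<? i ]

      trichotomy : ∀ (i j : Fin n) → [ j Fin.≟ i ] + ([ i Fin.<? j ] + [ j Fin.<? i ]) ≡ 1
      trichotomy i j with Fin.<-cmp i j
      ... | tri< i<j i≢j _ = cong₂ _+_ ([]-no (j Fin.≟ i) (i≢j ∘ ≡.sym))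
                               (cong₂ _+_ ([]-yes (i Fin.<? j) i<j) ([]-no (j Fin.<? i) (Fin.<-asym i<j)))
      ... | tri≈ _ refl _  = cong₂ _+_ ([]-yes (i Fin.≟ i) refl)
                               (cong₂ _+_ ([]-no (i Fin.<? i) (Fin.<-irrefl refl)) ([]-no (i Fin.<? i) (Fin.<-irrefl refl)))
      ... | tri> _ i≢j j<i = cong₂ _+_ ([]-no (j Fin.≟ i) (i≢j ∘ ≡.sym))
                               (cong₂ _+_ ([]-no (i Fin.<? j) (Fin.<-asym j<i)) ([]-yes (j Fin.<? i) j<i))

      sum-1 : ∀ m → sum {m} (λ _ → 1) ≡ m
      sum-1 ℕ.zero    = refl
      sum-1 (ℕ.suc m) = cong suc (sum-1 m)

      -- σ is a permutation, and reindexing by it turns descents into ascents.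
      descents≡ascents : sum desc ≡ ascents
      descents≡ascents = ≡.trans
        (sum-cong-≗ λ i → cong (λ j → [ σ i Fin.<? j ]) (≡.sym (σ-involutive i)))
        (≡.sym (sum-permute asc (permutation σ σ σ-involutive σ-involutive)))

    n≡fixedPoints+2*ascents : n ≡ fixedPoints + 2 * ascents
    n≡fixedPoints+2*ascents = begin
      n                                              ≡⟨ sum-1 n ⟨
      sum {n} (λ _ → 1)                              ≡⟨ sum-cong-≗ (λ i → ≡.sym (trichotomy i (σ i))) ⟩
      sum (λ i → [ σ i Fin.≟ i ] + (asc i + desc i)) ≡⟨ ∑-distrib-+ (λ i → [ σ i Fin.≟ i ]) _ ⟩
      fixedPoints + sum (λ i → asc i + desc i)       ≡⟨ cong (fixedPoints +_) (∑-distrib-+ asc desc) ⟩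
      fixedPoints + (ascents + sum desc)             ≡⟨ cong (λ d → fixedPoints + (ascents + d)) descents≡ascents ⟩
      fixedPoints + (ascents + ascents)              ≡⟨ cong (λ d → fixedPoints + (ascents + d)) (ℕ.+-identityʳ ascents) ⟨
      fixedPoints + 2 * ascents                      ∎
      where open ≡.≡-Reasoning

    fixedPointFree⇒even : (∀ i → σ i ≢ i) → 2 ∣ n
    fixedPointFree⇒even σi≢i = divides ascents (begin
      n                         ≡⟨ n≡fixedPoints+2*ascents ⟩
      fixedPoints + 2 * ascents ≡⟨ cong (_+ 2 * ascents) fixedPoints≡0 ⟩
      2 * ascents               ≡⟨ ℕ.*-comm 2 ascents ⟩
      ascents * 2               ∎)
      where
        open ≡.≡-Reasoning
        fixedPoints≡0 : fixedPoints ≡ 0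
        fixedPoints≡0 = ≡.trans (sum-cong-≗ λ i → []-no (σ i Fin.≟ i) (σi≢i i)) (sum-replicate-zero n)

    uniqueFixedPoint⇒odd : ∀ {i₀} → σ i₀ ≡ i₀ → (∀ i → σ i ≡ i → i ≡ i₀) → ¬ 2 ∣ n
    uniqueFixedPoint⇒odd {i₀} σi₀≡i₀ unique 2∣n =
      2≢1 (∣1⇒≡1 (∣m+n∣m⇒∣n (≡.subst (2 ∣_) n≡2*ascents+1 2∣n) (m∣m*n ascents)))
      where
        2≢1 : 2 ≢ 1
        2≢1 ()
        fixedPoints≡1 : fixedPoints ≡ 1
        fixedPoints≡1 = sum-unitVector _ i₀ ([]-yes (σ i₀ Fin.≟ i₀) σi₀≡i₀)
          λ i i≢i₀ → []-no (σ i Fin.≟ i) (i≢i₀ ∘ unique i)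
        n≡2*ascents+1 : n ≡ 2 * ascents + 1
        n≡2*ascents+1 = ≡.trans n≡fixedPoints+2*ascents
          (≡.trans (cong (_+ 2 * ascents) fixedPoints≡1) (ℕ.+-comm 1 (2 * ascents)))

  module SetoidInvolutionParity {a ℓ} {S : Setoid a ℓ} {n} (card : Inverse (≡.setoid (Fin n)) S)
    (σ : Setoid.Carrier S → Setoid.Carrier S)
    (σ-cong : Congruent₁ (Setoid._≈_ S) σ) (σ-involutive : Involutive (Setoid._≈_ S) σ) where
    open Setoid S
    open Inverse card
    private
      σᶠ : Fin n → Fin n
      σᶠ i = from (σ (to i))

      σᶠ-involutive : ∀ i → σᶠ (σᶠ i) ≡ i
      σᶠ-involutive i = ≡.trans (from-cong (trans (σ-cong (strictlyInverseˡ _)) (σ-involutive (to i))))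
                                (strictlyInverseʳ i)

      σᶠ-fixed⇒σ-fixed : ∀ {i} → σᶠ i ≡ i → σ (to i) ≈ to i
      σᶠ-fixed⇒σ-fixed σᶠi≡i = trans (sym (strictlyInverseˡ _)) (to-cong σᶠi≡i)

      module Onᶠ = InvolutionParity σᶠ σᶠ-involutive

    fixedPointFree⇒even : (∀ x → ¬ σ x ≈ x) → 2 ∣ n
    fixedPointFree⇒even σx≉x = Onᶠ.fixedPointFree⇒even (λ i → σx≉x (to i) ∘ σᶠ-fixed⇒σ-fixed)

    uniqueFixedPoint⇒odd : ∀ {x₀} → σ x₀ ≈ x₀ → (∀ x → σ x ≈ x → x ≈ x₀) → ¬ 2 ∣ n
    uniqueFixedPoint⇒odd {x₀} σx₀≈x₀ unique = Onᶠ.uniqueFixedPoint⇒odd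
      (from-cong (trans (σ-cong (strictlyInverseˡ x₀)) σx₀≈x₀))
      (λ i σᶠi≡i → ≡.trans (≡.sym (strictlyInverseʳ i)) (from-cong (unique (to i) (σᶠ-fixed⇒σ-fixed σᶠi≡i))))

p∣m^n⇒p∣m : ∀ {p m n} → Prime p → p ∣ m ℕ.^ n → p ∣ m
p∣m^n⇒p∣m {n = ℕ.zero}  p-prime p∣1 = contradiction (≡.subst Prime (∣1⇒≡1 p∣1) p-prime) ¬prime[1]
p∣m^n⇒p∣m {m = m} {n = ℕ.suc n} p-prime p∣m^[1+n] with euclidsLemma m (m ℕ.^ n) p-prime p∣m^[1+n]
... | inj₁ p∣m   = p∣m
... | inj₂ p∣m^n = p∣m^n⇒p∣m {n = n} p-prime p∣m^n

module CommutativeRingProperties {c ℓ} (R : CommutativeRing c ℓ) where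
  open CommutativeRing R
  open RawSemiring (Semiring.rawSemiring semiring) using (_^_)
  open import Algebra.Properties.Ring ring using (-1*x≈-x; -‿involutive; -0#≈0#)
  open import Algebra.Properties.CommutativeSemiring.Exp commutativeSemiring using (^-distrib-*)
  open import Data.Nat.Divisibility using (divides)

  1^n≈1 : ∀ n → 1# ^ n ≈ 1#
  1^n≈1 ℕ.zero    = refl
  1^n≈1 (ℕ.suc n) = trans (*-identityˡ _) (1^n≈1 n)

  0^n≈0 : ∀ n → .{{ℕ.NonZero n}} → 0# ^ n ≈ 0#
  0^n≈0 (ℕ.suc n) = zeroˡ _

  [-1]^n≈-1 : ∀ n → ¬ 2 ∣ n → (- 1#) ^ n ≈ - 1#
  [-1]^n≈-1 ℕ.zero 2∤0 = contradiction (divides 0 ≡.refl) 2∤0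
  [-1]^n≈-1 (ℕ.suc ℕ.zero) _ = *-identityʳ (- 1#)
  [-1]^n≈-1 (ℕ.suc (ℕ.suc n)) 2∤n+2 = begin
    - 1# * (- 1# * (- 1#) ^ n) ≈⟨ -1*x≈-x _ ⟩
    - (- 1# * (- 1#) ^ n)      ≈⟨ -‿cong (-1*x≈-x _) ⟩
    - - ((- 1#) ^ n)           ≈⟨ -‿involutive _ ⟩
    (- 1#) ^ n                 ≈⟨ [-1]^n≈-1 n 2∤n ⟩
    - 1#                       ∎
    where
      open import Relation.Binary.Reasoning.Setoid setoid
      2∤n : ¬ 2 ∣ n
      2∤n (divides k n≡k*2) = 2∤n+2 (divides (ℕ.suc k) (≡.cong (2 ℕ.+_) n≡k*2))

  fixed-scalar-^ : ∀ {c} k → c ^ k ≈ c → ∀ b → (c * b) ^ k ≈ c * b ^ k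
  fixed-scalar-^ {c} k cᵏ≈c b = trans (^-distrib-* c b k) (*-congʳ cᵏ≈c)

  x≈0∧y≈0⇒x-y≈0 : ∀ {x y} → x ≈ 0# → y ≈ 0# → x - y ≈ 0#
  x≈0∧y≈0⇒x-y≈0 x≈0 y≈0 = trans (+-cong x≈0 (-‿cong y≈0)) (trans (+-identityˡ _) -0#≈0#)

module FiniteFieldProperties {n : ℕ} (K : FiniteField n) where
  open FiniteField K
  open import Algebra.Properties.Group +-group using (identityʳ-unique)
  open import Algebra.Properties.Ring ring using (-‿involutive; -0#≈0#)
  import Data.Fin.Properties as Fin
  open import Data.Sum using (_⊎_)
  open import Function.Properties.Bijection using (Bijection⇒Inverse)
  open import Function.Properties.Inverse using (Inverse⇒Injection)
  import Function.Construct.Symmetry as Symmetry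
  open import Relation.Binary.Definitions using (Decidable)
  open import Relation.Nullary using (yes; no)
  open import Relation.Nullary.Decidable using (via-injection)
  open import Relation.Binary.Reasoning.Setoid setoid
  open FinInvolution using (module SetoidInvolutionParity)

  infix 4 _≈?_
  _≈?_ : Decidable _≈_
  _≈?_ = via-injection (Inverse⇒Injection (Symmetry.inverse (Bijection⇒Inverse card))) Fin._≟_

  x≉0∧x*y≈0⇒y≈0 : ∀ {x y} → ¬ x ≈ 0# → x * y ≈ 0# → y ≈ 0#
  x≉0∧x*y≈0⇒y≈0 {x} {y} x≉0 x*y≈0 with inverse x x≉0
  ... | x⁻¹ , x*x⁻¹≈1 = begin
    y              ≈⟨ *-identityˡ y ⟨
    1# * y         ≈⟨ *-congʳ (trans (sym x*x⁻¹≈1) (*-comm x x⁻¹)) ⟩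
    x⁻¹ * x * y    ≈⟨ *-assoc x⁻¹ x y ⟩
    x⁻¹ * (x * y)  ≈⟨ *-congˡ x*y≈0 ⟩
    x⁻¹ * 0#       ≈⟨ zeroʳ x⁻¹ ⟩
    0#             ∎

  x≉0∧y≉0⇒x*y≉0 : ∀ {x y} → ¬ x ≈ 0# → ¬ y ≈ 0# → ¬ x * y ≈ 0#
  x≉0∧y≉0⇒x*y≉0 x≉0 y≉0 = y≉0 ∘ x≉0∧x*y≈0⇒y≈0 x≉0

  x*y≈0⇒x≈0⊎y≈0 : ∀ {x y} → x * y ≈ 0# → x ≈ 0# ⊎ y ≈ 0#
  x*y≈0⇒x≈0⊎y≈0 {x} x*y≈0 with x ≈? 0#
  ... | yes x≈0 = inj₁ x≈0
  ... | no  x≉0 = inj₂ (x≉0∧x*y≈0⇒y≈0 x≉0 x*y≈0)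

  x^n≈0⇒x≈0 : ∀ {x} n → x ^ n ≈ 0# → x ≈ 0#
  x^n≈0⇒x≈0 ℕ.zero    1≈0 = contradiction (sym 1≈0) 0≉1
  x^n≈0⇒x≈0 (ℕ.suc n) x*xⁿ≈0 with x*y≈0⇒x≈0⊎y≈0 x*xⁿ≈0
  ... | inj₁ x≈0  = x≈0
  ... | inj₂ xⁿ≈0 = x^n≈0⇒x≈0 n xⁿ≈0

  x^m*x^n≈0⇒x≈0 : ∀ {x} m n → x ^ m * x ^ n ≈ 0# → x ≈ 0#
  x^m*x^n≈0⇒x≈0 m n xᵐ*xⁿ≈0 with x*y≈0⇒x≈0⊎y≈0 xᵐ*xⁿ≈0
  ... | inj₁ xᵐ≈0 = x^n≈0⇒x≈0 m xᵐ≈0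
  ... | inj₂ xⁿ≈0 = x^n≈0⇒x≈0 n xⁿ≈0

  -- If 1 + 1 ≉ 0 then x ↦ - x is an involution of K fixing only 0, so n is odd.
  even-order⇒1+1≈0 : 2 ∣ n → 1# + 1# ≈ 0#
  even-order⇒1+1≈0 2∣n with 1# + 1# ≈? 0#
  ... | yes 1+1≈0 = 1+1≈0
  ... | no  1+1≉0 = contradiction 2∣n
        (uniqueFixedPoint⇒odd -0#≈0# (λ x -x≈x → x≉0∧x*y≈0⇒y≈0 1+1≉0 (2x≈0 x -x≈x)))
    where
      open SetoidInvolutionParity (Bijection⇒Inverse card) -_ -‿cong -‿involutive
      2x≈0 : ∀ x → - x ≈ x → (1# + 1#) * x ≈ 0#
      2x≈0 x -x≈x = begin
        (1# + 1#) * x     ≈⟨ distribʳ x 1# 1# ⟩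
        1# * x + 1# * x   ≈⟨ +-cong (*-identityˡ x) (*-identityˡ x) ⟩
        x + x             ≈⟨ +-congˡ -x≈x ⟨
        x + - x           ≈⟨ -‿inverseʳ x ⟩
        0#                ∎

  -- If 1 + 1 ≈ 0 then x ↦ x + 1 is a fixed-point-free involution of K, so n is even.
  odd-order⇒1+1≉0 : ¬ 2 ∣ n → ¬ 1# + 1# ≈ 0#
  odd-order⇒1+1≉0 2∤n 1+1≈0 = 2∤n (fixedPointFree⇒even λ x x+1≈x → 0≉1 (sym (identityʳ-unique x 1# x+1≈x)))
    where
      [x+1]+1≈x : ∀ x → x + 1# + 1# ≈ x
      [x+1]+1≈x x = trans (+-assoc x 1# 1#) (trans (+-congˡ 1+1≈0) (+-identityʳ x))
      open SetoidInvolutionParity (Bijection⇒Inverse card) (_+ 1#) +-congʳ [x+1]+1≈x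

module Intersection {n : ℕ} (q : ℕ) (K : FiniteField n) where
  open FiniteField K hiding (zero)
  open Geometry q K
  open FiniteFieldProperties K
  open CommutativeRingProperties commRing
  open IntegerCoefficients commRing using (Polynomial; con; _:+_; _:*_; _:-_; solve; _:=_)
  open import Algebra.Properties.Group +-group using (x∙y⁻¹≈ε⇒x≈y)
  open import Algebra.Properties.Semiring.Exp semiring using (^-congˡ; ^-assocʳ)
  open import Data.Fin.Base using (Fin)
  open import Data.Fin.Patterns using (0F; 1F; 2F)
  open import Data.Integer using (+_; -[1+_])
  open import Relation.Binary.Reasoning.Setoid setoid

  2# : Carrier
  2# = 1# + 1#

  private
    infixl 6 _⊕_ _⊖_
    infixl 7 _⊛_
    _⊕_ : ∀ {x x′ y y′} → x ≈ x′ → y ≈ y′ → x + y ≈ x′ + y′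
    _⊕_ = +-cong
    _⊖_ : ∀ {x x′ y y′} → x ≈ x′ → y ≈ y′ → x - y ≈ x′ - y′
    x≈x′ ⊖ y≈y′ = +-cong x≈x′ (-‿cong y≈y′)
    _⊛_ : ∀ {x x′ y y′} → x ≈ x′ → y ≈ y′ → x * y ≈ x′ * y′
    _⊛_ = *-cong

  det3-cong : ∀ {A B : Fin 3 → Fin 3 → Carrier} → (∀ i j → A i j ≈ B i j) → det3 A ≈ det3 B
  det3-cong A≈B =
      A≈B 0F 0F ⊛ (A≈B 1F 1F ⊛ A≈B 2F 2F ⊖ A≈B 1F 2F ⊛ A≈B 2F 1F)
    ⊖ A≈B 0F 1F ⊛ (A≈B 1F 0F ⊛ A≈B 2F 2F ⊖ A≈B 1F 2F ⊛ A≈B 2F 0F)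
    ⊕ A≈B 0F 2F ⊛ (A≈B 1F 0F ⊛ A≈B 2F 1F ⊖ A≈B 1F 1F ⊛ A≈B 2F 0F)

  sym3 : (A B C x y z : Carrier) → Fin 3 → Fin 3 → Carrier
  sym3 A B C x y z 0F 0F = A
  sym3 A B C x y z 0F 1F = x
  sym3 A B C x y z 0F 2F = z
  sym3 A B C x y z 1F 0F = x
  sym3 A B C x y z 1F 1F = B
  sym3 A B C x y z 1F 2F = y
  sym3 A B C x y z 2F 0F = z
  sym3 A B C x y z 2F 1F = y
  sym3 A B C x y z 2F 2F = C

  sym3-cong : ∀ {A A′ B B′ C C′ x x′ y y′ z z′} →
    A ≈ A′ → B ≈ B′ → C ≈ C′ → x ≈ x′ → y ≈ y′ → z ≈ z′ →
    ∀ i j → sym3 A B C x y z i j ≈ sym3 A′ B′ C′ x′ y′ z′ i j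
  sym3-cong A≈ B≈ C≈ x≈ y≈ z≈ = λ where
    0F 0F → A≈ ; 0F 1F → x≈ ; 0F 2F → z≈
    1F 0F → x≈ ; 1F 1F → B≈ ; 1F 2F → y≈
    2F 0F → z≈ ; 2F 1F → y≈ ; 2F 2F → C≈

  -- M a0 a1 is sym3 at the conjugates (a0, a0^q, a0^(q²)) and (a1, a1^q, a1^(q²)).
  atConjugates : (Carrier → Carrier → Carrier → Carrier → Carrier → Carrier → Carrier) →
                 Carrier → Carrier → Carrier
  atConjugates f b0 b1 = f b0 (b0 ^ q) (b0 ^ (q ℕ.* q)) b1 (b1 ^ q) (b1 ^ (q ℕ.* q))

  N : Carrier → Carrier
  N b = b * b ^ q * b ^ (q ℕ.* q)

  Q : (A B C x y z : Carrier) → Carrier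
  Q A B C x y z = A * y * y + C * x * x + B * z * z

  -- Δ t A B C x y z = det3 (sym3 A B C (t * x) (t * y) (t * z))
  Δ : (t A B C x y z : Carrier) → Carrier
  Δ t A B C x y z = A * B * C + 2# * (t * t * t) * (x * y * z) - t * t * Q A B C x y z

  private
    Qᵖ : ∀ {m} (A B C x y z : Polynomial m) → Polynomial m
    Qᵖ A B C x y z = A :* y :* y :+ C :* x :* x :+ B :* z :* z

    Δᵖ : ∀ {m} (t A B C x y z : Polynomial m) → Polynomial m
    Δᵖ t A B C x y z = A :* B :* C :+ con (+ 2) :* (t :* t :* t) :* (x :* y :* z) :- t :* t :* Qᵖ A B C x y z

  det3-sym3-scaled : ∀ c t A B C x y z →
    det3 (sym3 (c * A) (c * B) (c * C) (c * (t * x)) (c * (t * y)) (c * (t * z))) ≈ c * c * c * Δ t A B C x y z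
  det3-sym3-scaled = solve 8 (λ c t A B C x y z →
      let A′ = c :* A ; B′ = c :* B ; C′ = c :* C ; x′ = c :* (t :* x) ; y′ = c :* (t :* y) ; z′ = c :* (t :* z) in
      A′ :* (B′ :* C′ :- y′ :* y′) :- x′ :* (x′ :* C′ :- y′ :* z′) :+ z′ :* (x′ :* y′ :- B′ :* z′)
    := c :* c :* c :* Δᵖ t A B C x y z) refl

  Δ₁-Δ₋₁ : ∀ A B C x y z → Δ 1# A B C x y z - Δ (- 1#) A B C x y z ≈ 2# * (2# * (x * y * z))
  Δ₁-Δ₋₁ = solve 6 (λ A B C x y z →
    Δᵖ (con (+ 1)) A B C x y z :- Δᵖ (con -[1+ 0 ]) A B C x y z := con (+ 2) :* (con (+ 2) :* (x :* y :* z))) refl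

  Δ₀ : ∀ A B C x y z → Δ 0# A B C x y z ≈ A * B * C
  Δ₀ = solve 6 (λ A B C x y z → Δᵖ (con (+ 0)) A B C x y z := A :* B :* C) refl

  Δ₁-Δₜ : ∀ t A B C x y z → Δ 1# A B C x y z - Δ t A B C x y z ≈
    (t - 1#) * (t - 1#) * Q A B C x y z + 2# * ((t - 1#) * Q A B C x y z + (1# - t * t * t) * (x * y * z))
  Δ₁-Δₜ = solve 7 (λ t A B C x y z →
      Δᵖ (con (+ 1)) A B C x y z :- Δᵖ t A B C x y z
    := (t :- con (+ 1)) :* (t :- con (+ 1)) :* Qᵖ A B C x y z
       :+ con (+ 2) :* ((t :- con (+ 1)) :* Qᵖ A B C x y z :+ (con (+ 1) :- t :* t :* t) :* (x :* y :* z))) refl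

  ABC≈Δ₁+Q-2xyz : ∀ A B C x y z → A * B * C ≈ Δ 1# A B C x y z + Q A B C x y z - 2# * (x * y * z)
  ABC≈Δ₁+Q-2xyz = solve 6 (λ A B C x y z →
    A :* B :* C := Δᵖ (con (+ 1)) A B C x y z :+ Qᵖ A B C x y z :- con (+ 2) :* (x :* y :* z)) refl

  InFq⇒c^[q*q]≈c : ∀ {c} → InFq c → c ^ (q ℕ.* q) ≈ c
  InFq⇒c^[q*q]≈c {c} c^q≈c = trans (sym (^-assocʳ c q q)) (trans (^-congˡ q c^q≈c) c^q≈c)

  ≈⇒SamePoint : ∀ {a0 a1 b0 b1} → a0 ≈ b0 → a1 ≈ b1 → SamePoint a0 a1 b0 b1
  ≈⇒SamePoint a0≈b0 a1≈b1 =
    1# , 1^n≈1 q , (0≉1 ∘ sym) , trans a0≈b0 (sym (*-identityˡ _)) , trans a1≈b1 (sym (*-identityˡ _))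

  det3-M-scaled : ∀ {c t a0 a1 b0 b1} → InFq c → InFq t → a0 ≈ c * b0 → a1 ≈ c * (t * b1) →
    det3 (M a0 a1) ≈ c * c * c * atConjugates (Δ t) b0 b1
  det3-M-scaled {c} {t} {a0} {a1} {b0} {b1} c∈Fq t∈Fq a0≈cb0 a1≈ctb1 = begin
    det3 (M a0 a1)
      ≈⟨ det3-cong (sym3-cong a0≈cb0 (conjugate q c∈Fq) (conjugate (q ℕ.* q) (InFq⇒c^[q*q]≈c c∈Fq))
                              a1≈ctb1 (conjugate₁ q c∈Fq t∈Fq)
                              (conjugate₁ (q ℕ.* q) (InFq⇒c^[q*q]≈c c∈Fq) (InFq⇒c^[q*q]≈c t∈Fq))) ⟩
    det3 (sym3 (c * b0) (c * b0 ^ q) (c * b0 ^ (q ℕ.* q))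
               (c * (t * b1)) (c * (t * b1 ^ q)) (c * (t * b1 ^ (q ℕ.* q))))
      ≈⟨ det3-sym3-scaled c t b0 _ _ b1 _ _ ⟩
    c * c * c * atConjugates (Δ t) b0 b1 ∎
    where
      conjugate : ∀ k → c ^ k ≈ c → a0 ^ k ≈ c * b0 ^ k
      conjugate k cᵏ≈c = trans (^-congˡ k a0≈cb0) (fixed-scalar-^ k cᵏ≈c b0)
      conjugate₁ : ∀ k → c ^ k ≈ c → t ^ k ≈ t → a1 ^ k ≈ c * (t * b1 ^ k)
      conjugate₁ k cᵏ≈c tᵏ≈t = trans (^-congˡ k a1≈ctb1)
        (trans (fixed-scalar-^ k cᵏ≈c (t * b1)) (*-congˡ (fixed-scalar-^ k tᵏ≈t b1)))

  singular⇒Δ≈0 : ∀ {t a0 a1 b0 b1} → InFq t → SamePoint a0 a1 b0 (t * b1) →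
    det3 (M a0 a1) ≈ 0# → atConjugates (Δ t) b0 b1 ≈ 0#
  singular⇒Δ≈0 t∈Fq (c , c∈Fq , c≉0 , a0≈cb0 , a1≈ctb1) det≈0 =
    x≉0∧x*y≈0⇒y≈0 (x≉0∧y≉0⇒x*y≉0 (x≉0∧y≉0⇒x*y≉0 c≉0 c≉0) c≉0)
      (trans (sym (det3-M-scaled c∈Fq t∈Fq a0≈cb0 a1≈ctb1)) det≈0)

  S1⇒Δ₁≈0 : ∀ {b0 b1} → det3 (M b0 b1) ≈ 0# → atConjugates (Δ 1#) b0 b1 ≈ 0#
  S1⇒Δ₁≈0 = singular⇒Δ≈0 (1^n≈1 q) (≈⇒SamePoint refl (sym (*-identityˡ _)))

  N≈0⇒≈0 : ∀ {b} → N b ≈ 0# → b ≈ 0#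
  N≈0⇒≈0 = x^m*x^n≈0⇒x≈0 (ℕ.suc q) (q ℕ.* q)

  S1∩S₋₁=∅ : .{{ℕ.NonZero q}} → ¬ 2# ≈ 0# → InFq (- 1#) → ∀ a0 a1 → ¬ (InS1 a0 a1 × InS (- 1#) a0 a1)
  S1∩S₋₁=∅ 2≉0 -1∈Fq a0 a1 ((_ , det-a≈0) , b0 , b1 , (b≉0 , det-b≈0) , a≈b) = b≉0 (b0≈0 , b1≈0)
    where
      4Nb1≈0 : 2# * (2# * N b1) ≈ 0#
      4Nb1≈0 = trans (sym (Δ₁-Δ₋₁ b0 _ _ b1 _ _))
                     (x≈0∧y≈0⇒x-y≈0 (S1⇒Δ₁≈0 det-b≈0) (singular⇒Δ≈0 -1∈Fq a≈b det-a≈0))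
      b1≈0 : b1 ≈ 0#
      b1≈0 = N≈0⇒≈0 (x≉0∧x*y≈0⇒y≈0 2≉0 (x≉0∧x*y≈0⇒y≈0 2≉0 4Nb1≈0))
      -- Now M(b0, b1) = M(b0, 0 · b1), whose determinant is the norm of b0.
      b0≈0 : b0 ≈ 0#
      b0≈0 = N≈0⇒≈0 (trans (sym (Δ₀ b0 _ _ b1 _ _))
        (singular⇒Δ≈0 (0^n≈0 q) (≈⇒SamePoint refl (trans b1≈0 (sym (zeroˡ b1)))) det-b≈0))

  S1∩Sα⊆NuclearPlane : 2# ≈ 0# → ∀ α → InFq α → ¬ α ≈ 1# →
    ∀ a0 a1 → InS1 a0 a1 → InS α a0 a1 → InNuclearPlane a0 a1
  S1∩Sα⊆NuclearPlane 2≈0 α α∈Fq α≉1 a0 a1 (a≉0 , det-a≈0)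
                     (b0 , b1 , (_ , det-b≈0) , a≈b@(c , _ , _ , a0≈cb0 , _)) =
    a≉0 , a1 , a1≉0 , ≈⇒SamePoint a0≈0 refl
    where
      Qb : Carrier
      Qb = atConjugates Q b0 b1
      Δ₁≈0 : atConjugates (Δ 1#) b0 b1 ≈ 0#
      Δ₁≈0 = S1⇒Δ₁≈0 det-b≈0
      2y≈0 : ∀ y → 2# * y ≈ 0#
      2y≈0 y = trans (*-congʳ 2≈0) (zeroˡ y)
      [α-1]²Q≈0 : (α - 1#) * (α - 1#) * Qb ≈ 0#
      [α-1]²Q≈0 = begin
        (α - 1#) * (α - 1#) * Qb                             ≈⟨ +-identityʳ _ ⟨
        (α - 1#) * (α - 1#) * Qb + 0#                        ≈⟨ +-congˡ (2y≈0 _) ⟨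
        (α - 1#) * (α - 1#) * Qb + 2# * _                    ≈⟨ Δ₁-Δₜ α b0 _ _ b1 _ _ ⟨
        atConjugates (Δ 1#) b0 b1 - atConjugates (Δ α) b0 b1 ≈⟨ x≈0∧y≈0⇒x-y≈0 Δ₁≈0 (singular⇒Δ≈0 α∈Fq a≈b det-a≈0) ⟩
        0#                                                   ∎
      α-1≉0 : ¬ α - 1# ≈ 0#
      α-1≉0 = α≉1 ∘ x∙y⁻¹≈ε⇒x≈y α 1#
      Qb≈0 : Qb ≈ 0#
      Qb≈0 = x≉0∧x*y≈0⇒y≈0 (x≉0∧y≉0⇒x*y≉0 α-1≉0 α-1≉0) [α-1]²Q≈0
      b0≈0 : b0 ≈ 0#
      b0≈0 = N≈0⇒≈0 (begin
        N b0                                       ≈⟨ ABC≈Δ₁+Q-2xyz b0 _ _ b1 _ _ ⟩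
        atConjugates (Δ 1#) b0 b1 + Qb - 2# * N b1 ≈⟨ x≈0∧y≈0⇒x-y≈0 (trans (+-cong Δ₁≈0 Qb≈0) (+-identityˡ 0#)) (2y≈0 _) ⟩
        0#                                         ∎)
      a0≈0 : a0 ≈ 0#
      a0≈0 = trans a0≈cb0 (trans (*-congˡ b0≈0) (zeroʳ c))
      a1≉0 : ¬ a1 ≈ 0#
      a1≉0 a1≈0 = a≉0 (a0≈0 , a1≈0)

open import Data.Nat using (_^_)

theorem4p7 : (q : ℕ) → 2 < q → IsPrimePower q → (K : FiniteField (q ^ 3)) →
    let open FiniteField K in
    let open Geometry q K in
    (¬ (2 ∣ q) → ∀ a0 a1 → ¬ (InS1 a0 a1 × InS (- 1#) a0 a1))
    × (2 ∣ q → ∀ α → InFq α → ¬ (α ≈ 0#) → ¬ (α ≈ 1#) →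
         ∀ a0 a1 → InS1 a0 a1 → InS α a0 a1 → InNuclearPlane a0 a1)
theorem4p7 q@(ℕ.suc _) _ _ K =
    (λ 2∤q → S1∩S₋₁=∅ (odd-order⇒1+1≉0 (2∤q ∘ p∣m^n⇒p∣m {n = 3} prime[2])) ([-1]^n≈-1 q 2∤q))
  , (λ 2∣q α α∈Fq _ → S1∩Sα⊆NuclearPlane (even-order⇒1+1≈0 (∣m⇒∣m*n _ 2∣q)) α α∈Fq)
  where
    open Intersection q K
    open FiniteFieldProperties K
    open CommutativeRingProperties (FiniteField.commRing K)
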